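{- The relation $=_{\mathit{clfe}}$ on $\mathcal{SP}_A$ (defined by $P=_{\mathit{clfe}}Q\iff\mathit{clfe}(P)=\mathit{clfe}(Q)$) and the relation $=_{\mathit{clfe}^{\mathsf U}}$ on $\mathcal{SP}^{\mathsf U}_A$ (defined by $P=_{\mathit{clfe}^{\mathsf U}}Q\iff\mathit{clfe}^{\mathsf U}(P)=\mathit{clfe}^{\mathsf U}(Q)$) are both congruences with respect to $\neg$, $\mathbin{\wedge_\bullet}$ and $\mathbin{\vee_\bullet}$.
   Context: Let $A$ be a countable set of atoms, totally ordered as $a_1<a_2<\cdots$. $\mathcal{SP}^{\mathsf U}_A$: closed terms generated by $P::=\mathsf T\mid\mathsf F\mid\mathsf U\mid a\mid \neg P\mid P\mathbin{\wedge_\bullet}P\mid P\mathbin{\vee_\bullet}P$ ($a\in A$); $\mathcal{SP}_A$ is the subset of terms not containing $\mathsf U$. $\alpha(P)$ is the set of atoms occurring in $P$. For a string $\beta$ over $A$ with strictly increasing letters: $\widetilde{\mathsf F}_\epsilon=\mathsf F$, $\widetilde{\mathsf F}_{a\rho}=a\mathbin{\wedge_\bullet}\widetilde{\mathsf F}_\rho$. Trees: $\mathsf T,\mathsf F,\mathsf U$ are trees and $(X\trianglelefteq a\trianglerighteq Y)$ is a tree for trees $X,Y$ and $a\in A$. Leaf replacement $X[\mathsf T\mapsto Y,\mathsf F\mapsto Z]$ replaces leaves $\mathsf T$ by $Y$, $\mathsf F$ by $Z$ and keeps $\mathsf U$; omitted replacements are identities. $\mathit{fe}^{\mathsf U}(B)=B$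 ($B\in\{\mathsf T,\mathsf F,\mathsf U\}$), $\mathit{fe}^{\mathsf U}(a)=\mathsf T\trianglelefteq a\trianglerighteq\mathsf F$, $\mathit{fe}^{\mathsf U}(\neg P)=\mathit{fe}^{\mathsf U}(P)[\mathsf T\mapsto\mathsf F,\mathsf F\mapsto\mathsf T]$, $\mathit{fe}^{\mathsf U}(P\mathbin{\wedge_\bullet}Q)=\mathit{fe}^{\mathsf U}(P)[\mathsf T\mapsto\mathit{fe}^{\mathsf U}(Q),\mathsf F\mapsto\mathit{fe}^{\mathsf U}(Q)[\mathsf T\mapsto\mathsf F]]$, $\mathit{fe}^{\mathsf U}(P\mathbin{\vee_\bullet}Q)=\mathit{fe}^{\mathsf U}(P)[\mathsf T\mapsto\mathit{fe}^{\mathsf U}(Q)[\mathsf F\mapsto\mathsf T],\mathsf F\mapsto\mathit{fe}^{\mathsf U}(Q)]$. $L_a(B)=R_a(B)=B$ for leaves; $L_a(X\trianglelefteq b\trianglerighteq Y)=L_a(X)$ if $b=a$, else $L_a(X)\trianglelefteq b\trianglerighteq L_a(Y)$; $R_a(X\trianglelefteq b\trianglerighteq Y)=R_a(Y)$ if $b=a$, else $R_a(X)\trianglelefteq b\trianglerighteq R_a(Y)$; $m(B)=B$, $m(X\trianglelefteq a\trianglerighteq Y)=m(L_a(X))\trianglelefteq a\trianglerighteq m(R_a(Y))$. $\mathit{mfe}^{\mathsf U}(P)=m(\mathit{fe}^{\mathsf U}(P))$, and $\mathit{mfe}$ is its restriction to $\mathcal{SP}_A$. For $P\in\mathcal{SP}_A$,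 $\mathit{clfe}(P)=\mathit{mfe}(\widetilde{\mathsf F}_\beta\mathbin{\vee_\bullet}P)$, where $\beta$ is the strictly increasing string with letter set $\alpha(P)$. For $P\in\mathcal{SP}^{\mathsf U}_A$: $\mathit{clfe}^{\mathsf U}(P)=\mathit{mfe}^{\mathsf U}(\widetilde{\mathsf F}_\beta\mathbin{\vee_\bullet}P)$ (same $\beta$) if $P\in\mathcal{SP}_A$, and $\mathit{clfe}^{\mathsf U}(P)=\mathsf U$ otherwise. -}

module Defs where

open import Data.Nat using (ℕ; _<ᵇ_; _≡ᵇ_; _+_)
open import Relation.Binary.PropositionalEquality using (_≡_)
open import Data.Bool using (Bool; true; false; if_then_else_)
open import Data.List using (List; []; _∷_; foldr)
open import Data.Maybe using (Maybe; just; nothing)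

-- Atoms: A = {a₁ < a₂ < ⋯} represented by ℕ with its usual order.
Atom : Set
Atom = ℕ

data SPU : Set where
  T F U : SPU
  atom  : Atom → SPU
  ¬ᵤ_   : SPU → SPU
  _∧ᵤ_  : SPU → SPU → SPU
  _∨ᵤ_  : SPU → SPU → SPU

data SP : Set where
  T F  : SP
  atom : Atom → SP
  ¬ₛ_  : SP → SP
  _∧ₛ_ : SP → SP → SP
  _∨ₛ_ : SP → SP → SP

ι : SP → SPU
ι T = T
ι F = F
ι (atom a) = atom a
ι (¬ₛ P) = ¬ᵤ ι P
ι (P ∧ₛ Q) = ι P ∧ᵤ ι Q
ι (P ∨ₛ Q) = ι P ∨ᵤ ι Q

toSP : SPU → Maybe SP
toSP T = just T
toSP F = just F
toSP U = nothing
toSP (atom a) = just (atom a)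
toSP (¬ᵤ P) with toSP P
... | just p = just (¬ₛ p)
... | nothing = nothing
toSP (P ∧ᵤ Q) with toSP P | toSP Q
... | just p | just q = just (p ∧ₛ q)
... | _ | _ = nothing
toSP (P ∨ᵤ Q) with toSP P | toSP Q
... | just p | just q = just (p ∨ₛ q)
... | _ | _ = nothing

data Tree : Set where
  T F U : Tree
  node  : Tree → Atom → Tree → Tree   -- node X a Y  is  X ⊴ a ⊵ Y

_[T↦_,F↦_] : Tree → Tree → Tree → Tree
T [T↦ Y ,F↦ Z ] = Y
F [T↦ Y ,F↦ Z ] = Z
U [T↦ Y ,F↦ Z ] = U
node X a X' [T↦ Y ,F↦ Z ] = node (X [T↦ Y ,F↦ Z ]) a (X' [T↦ Y ,F↦ Z ])

feU : SPU → Tree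
feU T = T
feU F = F
feU U = U
feU (atom a) = node T a F
feU (¬ᵤ P) = feU P [T↦ F ,F↦ T ]
feU (P ∧ᵤ Q) = feU P [T↦ feU Q ,F↦ (feU Q [T↦ F ,F↦ F ]) ]
feU (P ∨ᵤ Q) = feU P [T↦ (feU Q [T↦ T ,F↦ T ]) ,F↦ feU Q ]

L : Atom → Tree → Tree
L a T = T
L a F = F
L a U = U
L a (node X b Y) = if a ≡ᵇ b then L a X else node (L a X) b (L a Y)

R : Atom → Tree → Tree
R a T = T
R a F = F
R a U = U
R a (node X b Y) = if a ≡ᵇ b then R a Y else node (R a X) b (R a Y)

-- Sizes do not increase under L / R; m is defined by recursion on a fuel
-- bound by the tree size (the fuel `size X` always suffices).
size : Tree → ℕ
size T = 1
size F = 1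
size U = 1
size (node X _ Y) = ℕ.suc (size X + size Y)

m′ : ℕ → Tree → Tree
m′ _ T = T
m′ _ F = F
m′ _ U = U
m′ ℕ.zero X = X
m′ (ℕ.suc n) (node X a Y) = node (m′ n (L a X)) a (m′ n (R a Y))

m : Tree → Tree
m X = m′ (size X) X

mfeU : SPU → Tree
mfeU P = m (feU P)

mfe : SP → Tree
mfe P = mfeU (ι P)

-- α(P) as a strictly increasing list of atoms
insert : Atom → List Atom → List Atom
insert a [] = a ∷ []
insert a (b ∷ bs) = if a <ᵇ b then a ∷ b ∷ bs
                    else (if a ≡ᵇ b then b ∷ bs else b ∷ insert a bs)

merge : List Atom → List Atom → List Atom
merge xs ys = foldr insert ys xs

α : SP → List Atom
α T = []
α F = []
α (atom a) = a ∷ []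
α (¬ₛ P) = α P
α (P ∧ₛ Q) = merge (α P) (α Q)
α (P ∨ₛ Q) = merge (α P) (α Q)

F̃ : List Atom → SP
F̃ [] = F
F̃ (a ∷ ρ) = atom a ∧ₛ F̃ ρ

clfe : SP → Tree
clfe P = mfe (F̃ (α P) ∨ₛ P)

clfeU : SPU → Tree
clfeU P with toSP P
... | just p = clfe p
... | nothing = U

_=clfe_ : SP → SP → Set
P =clfe Q = clfe P ≡ clfe Q

_=clfeU_ : SPU → SPU → Set
P =clfeU Q = clfeU P ≡ clfeU Q

module Submission where

-- clfe P is the complete decision tree over the atoms of P in increasing order
-- whose leaves are the truth values of P: fe (F̃_β ∨• P) is the full tree over β
-- with fe P at every leaf, and m unfolds it one atom at a time, each L / R step
-- fixing the value of that atom. So the atoms of P are read off the leftmost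
-- branch of clfe P and its valuations off the leaves, whence P =clfe Q iff
-- α P ≡ α Q and fe P, fe Q evaluate alike under every valuation; both
-- conditions are compositional. A term of SP^U either lies in SP, where clfe^U
-- is clfe and never U, or has clfe^U = U, so =clfe^U is =clfe lifted pointwise
-- to Maybe.

open import Defs
open import Data.Bool using (Bool; true; false; if_then_else_) renaming (T to True)
open import Data.Empty using (⊥-elim)
open import Data.List using (List; []; _∷_; length)
open import Data.List.Membership.Propositional using (_∈_; _∉_)
open import Data.List.Relation.Binary.Subset.Propositional using (_⊆_)
open import Data.List.Relation.Unary.All as All using (All; []; _∷_)
open import Data.List.Relation.Unary.All.Properties using (All¬⇒¬Any)
open import Data.List.Relation.Unary.AllPairs as AllPairs using (AllPairs; []; _∷_)
open import Data.List.Relation.Unary.Any using (here; there)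
open import Data.List.Relation.Unary.Unique.Propositional using (Unique)
open import Data.Maybe as Maybe using (Maybe; just; nothing; maybe′; zipWith)
open import Data.Maybe.Relation.Binary.Pointwise using (Pointwise; just; nothing)
open import Data.Nat using (suc; _<_; _≤_; z≤n; s≤s; _<ᵇ_; _≡ᵇ_)
open import Data.Nat.Properties
  using (≡ᵇ⇒≡; ≡⇒≡ᵇ; <ᵇ⇒<; <⇒<ᵇ; <⇒≢; ≮⇒≥; ≤∧≢⇒<; <-trans; ≤-trans; m≤m+n)
open import Data.Product using (_×_; _,_)
open import Function using (const; _∘_)
open import Function.Bundles using (_⇔_; mk⇔; Equivalence)
open import Relation.Binary.PropositionalEquality
open import Relation.Nullary using (¬_)

open Equivalence using (to; from)

≡ᵇ-true⇒≡ : ∀ {a b} → (a ≡ᵇ b) ≡ true → a ≡ b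
≡ᵇ-true⇒≡ {a} {b} e = ≡ᵇ⇒≡ a b (subst True (sym e) _)

≡ᵇ-false⇒≢ : ∀ {a b} → (a ≡ᵇ b) ≡ false → a ≢ b
≡ᵇ-false⇒≢ {a} {b} e a≡b = subst True e (≡⇒≡ᵇ a b a≡b)

<ᵇ-false⇒≮ : ∀ {a b} → (a <ᵇ b) ≡ false → ¬ a < b
<ᵇ-false⇒≮ e a<b = subst True e (<⇒<ᵇ a<b)

insert-All : ∀ {P : Atom → Set} a bs → P a → All P bs → All P (insert a bs)
insert-All a [] pa [] = pa ∷ []
insert-All a (b ∷ bs) pa (pb ∷ pbs) with a <ᵇ b | a ≡ᵇ b
... | true  | _     = pa ∷ pb ∷ pbs
... | false | true  = pb ∷ pbs
... | false | false = pb ∷ insert-All a bs pa pbs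

insert-sorted : ∀ a bs → AllPairs _<_ bs → AllPairs _<_ (insert a bs)
insert-sorted a [] [] = [] ∷ []
insert-sorted a (b ∷ bs) (b<bs ∷ sorted) with a <ᵇ b in a<ᵇb | a ≡ᵇ b in a≡ᵇb
... | true  | _     = (a<b ∷ All.map (<-trans a<b) b<bs) ∷ b<bs ∷ sorted
  where a<b = <ᵇ⇒< a b (subst True (sym a<ᵇb) _)
... | false | true  = b<bs ∷ sorted
... | false | false = insert-All a bs b<a b<bs ∷ insert-sorted a bs sorted
  where b<a = ≤∧≢⇒< (≮⇒≥ (<ᵇ-false⇒≮ a<ᵇb)) (λ b≡a → ≡ᵇ-false⇒≢ a≡ᵇb (sym b≡a))

merge-sorted : ∀ xs ys → AllPairs _<_ ys → AllPairs _<_ (merge xs ys)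
merge-sorted [] ys sorted = sorted
merge-sorted (x ∷ xs) ys sorted = insert-sorted x (merge xs ys) (merge-sorted xs ys sorted)

α-sorted : ∀ P → AllPairs _<_ (α P)
α-sorted T = []
α-sorted F = []
α-sorted (atom a) = [] ∷ []
α-sorted (¬ₛ P) = α-sorted P
α-sorted (P ∧ₛ Q) = merge-sorted (α P) (α Q) (α-sorted Q)
α-sorted (P ∨ₛ Q) = merge-sorted (α P) (α Q) (α-sorted Q)

α-unique : ∀ P → Unique (α P)
α-unique P = AllPairs.map <⇒≢ (α-sorted P)

∈-insert⁺ˡ : ∀ a bs → a ∈ insert a bs
∈-insert⁺ˡ a [] = here refl
∈-insert⁺ˡ a (b ∷ bs) with a <ᵇ b | a ≡ᵇ b in a≡ᵇb
... | true  | _     = here refl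
... | false | true  = here (≡ᵇ-true⇒≡ a≡ᵇb)
... | false | false = there (∈-insert⁺ˡ a bs)

∈-insert⁺ʳ : ∀ a bs → bs ⊆ insert a bs
∈-insert⁺ʳ a [] ()
∈-insert⁺ʳ a (b ∷ bs) x∈ with a <ᵇ b | a ≡ᵇ b | x∈
... | true  | _     | _        = there x∈
... | false | true  | _        = x∈
... | false | false | here x≡b = here x≡b
... | false | false | there x∈bs = there (∈-insert⁺ʳ a bs x∈bs)

merge⁺ˡ : ∀ xs ys → xs ⊆ merge xs ys
merge⁺ˡ (a ∷ xs) ys (here refl) = ∈-insert⁺ˡ a (merge xs ys)
merge⁺ˡ (a ∷ xs) ys (there x∈) = ∈-insert⁺ʳ a (merge xs ys) (merge⁺ˡ xs ys x∈)

merge⁺ʳ : ∀ xs ys → ys ⊆ merge xs ys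
merge⁺ʳ [] ys y∈ = y∈
merge⁺ʳ (a ∷ xs) ys y∈ = ∈-insert⁺ʳ a (merge xs ys) (merge⁺ʳ xs ys y∈)

data AtomsIn (β : List Atom) : Tree → Set where
  T    : AtomsIn β T
  F    : AtomsIn β F
  U    : AtomsIn β U
  node : ∀ {X a Y} → AtomsIn β X → a ∈ β → AtomsIn β Y → AtomsIn β (node X a Y)

AtomsIn-mono : ∀ {β γ X} → β ⊆ γ → AtomsIn β X → AtomsIn γ X
AtomsIn-mono β⊆γ T = T
AtomsIn-mono β⊆γ F = F
AtomsIn-mono β⊆γ U = U
AtomsIn-mono β⊆γ (node hX a∈ hY) = node (AtomsIn-mono β⊆γ hX) (β⊆γ a∈) (AtomsIn-mono β⊆γ hY)

AtomsIn-replace : ∀ {β X Y Z} → AtomsIn β X → AtomsIn β Y → AtomsIn β Z → AtomsIn β (X [T↦ Y ,F↦ Z ])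
AtomsIn-replace T hY hZ = hY
AtomsIn-replace F hY hZ = hZ
AtomsIn-replace U hY hZ = U
AtomsIn-replace (node hX a∈ hX′) hY hZ = node (AtomsIn-replace hX hY hZ) a∈ (AtomsIn-replace hX′ hY hZ)

∈-drop : ∀ {a b β} → (a ≡ᵇ b) ≡ false → b ∈ a ∷ β → b ∈ β
∈-drop a≢ᵇb (here b≡a) = ⊥-elim (≡ᵇ-false⇒≢ a≢ᵇb (sym b≡a))
∈-drop a≢ᵇb (there b∈) = b∈

AtomsIn-L : ∀ {a β X} → AtomsIn (a ∷ β) X → AtomsIn β (L a X)
AtomsIn-L T = T
AtomsIn-L F = F
AtomsIn-L U = U
AtomsIn-L {a} (node {a = b} hX b∈ hY) with a ≡ᵇ b in a≡ᵇb
... | true  = AtomsIn-L hX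
... | false = node (AtomsIn-L hX) (∈-drop a≡ᵇb b∈) (AtomsIn-L hY)

AtomsIn-R : ∀ {a β X} → AtomsIn (a ∷ β) X → AtomsIn β (R a X)
AtomsIn-R T = T
AtomsIn-R F = F
AtomsIn-R U = U
AtomsIn-R {a} (node {a = b} hX b∈ hY) with a ≡ᵇ b in a≡ᵇb
... | true  = AtomsIn-R hY
... | false = node (AtomsIn-R hX) (∈-drop a≡ᵇb b∈) (AtomsIn-R hY)

fe : SP → Tree
fe P = feU (ι P)

AtomsIn-fe : ∀ P → AtomsIn (α P) (fe P)
AtomsIn-fe T = T
AtomsIn-fe F = F
AtomsIn-fe (atom a) = node T (here refl) F
AtomsIn-fe (¬ₛ P) = AtomsIn-replace (AtomsIn-fe P) F T
AtomsIn-fe (P ∧ₛ Q) = AtomsIn-replace hP hQ (AtomsIn-replace hQ F F)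
  where
  hP = AtomsIn-mono (merge⁺ˡ (α P) (α Q)) (AtomsIn-fe P)
  hQ = AtomsIn-mono (merge⁺ʳ (α P) (α Q)) (AtomsIn-fe Q)
AtomsIn-fe (P ∨ₛ Q) = AtomsIn-replace hP (AtomsIn-replace hQ T T) hQ
  where
  hP = AtomsIn-mono (merge⁺ˡ (α P) (α Q)) (AtomsIn-fe P)
  hQ = AtomsIn-mono (merge⁺ʳ (α P) (α Q)) (AtomsIn-fe Q)

Valuation : Set
Valuation = Atom → Bool

_[_≔_] : Valuation → Atom → Bool → Valuation
(τ [ a ≔ v ]) c = if a ≡ᵇ c then v else τ c

[≔]-id : ∀ {τ a v} → τ a ≡ v → τ [ a ≔ v ] ≗ τ
[≔]-id {τ} {a} {v} τa≡v c with a ≡ᵇ c in a≡ᵇc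
... | true  = sym (subst (λ b → τ b ≡ v) (≡ᵇ-true⇒≡ a≡ᵇc) τa≡v)
... | false = refl

eval : Valuation → Tree → Tree
eval τ (node X a Y) = if τ a then eval τ X else eval τ Y
eval τ leaf = leaf

eval-cong : ∀ {σ τ} → σ ≗ τ → ∀ X → eval σ X ≡ eval τ X
eval-cong σ≗τ T = refl
eval-cong σ≗τ F = refl
eval-cong σ≗τ U = refl
eval-cong σ≗τ (node X a Y) rewrite σ≗τ a | eval-cong σ≗τ X | eval-cong σ≗τ Y = refl

eval-L : ∀ τ a X → eval τ (L a X) ≡ eval (τ [ a ≔ true ]) X
eval-L τ a T = refl
eval-L τ a F = refl
eval-L τ a U = refl
eval-L τ a (node X b Y) with a ≡ᵇ b
... | true  = eval-L τ a X
... | false with τ b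
...   | true  = eval-L τ a X
...   | false = eval-L τ a Y

eval-R : ∀ τ a X → eval τ (R a X) ≡ eval (τ [ a ≔ false ]) X
eval-R τ a T = refl
eval-R τ a F = refl
eval-R τ a U = refl
eval-R τ a (node X b Y) with a ≡ᵇ b
... | true  = eval-R τ a Y
... | false with τ b
...   | true  = eval-R τ a X
...   | false = eval-R τ a Y

eval-replace : ∀ τ X Y Z → eval τ (X [T↦ Y ,F↦ Z ]) ≡ eval τ X [T↦ eval τ Y ,F↦ eval τ Z ]
eval-replace τ T Y Z = refl
eval-replace τ F Y Z = refl
eval-replace τ U Y Z = refl
eval-replace τ (node X a X′) Y Z with τ a
... | true  = eval-replace τ X Y Z
... | false = eval-replace τ X′ Y Z

infix 4 _≈_

record _≈_ (X Y : Tree) : Set where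
  constructor eval-ext
  field eval-≡ : ∀ τ → eval τ X ≡ eval τ Y

open _≈_

≈-refl : ∀ {X} → X ≈ X
≈-refl = eval-ext λ τ → refl

replace-cong : ∀ {X X′ Y Y′ Z Z′} → X ≈ X′ → Y ≈ Y′ → Z ≈ Z′ →
               X [T↦ Y ,F↦ Z ] ≈ X′ [T↦ Y′ ,F↦ Z′ ]
replace-cong {X} {X′} {Y} {Y′} {Z} {Z′} X≈X′ Y≈Y′ Z≈Z′ = eval-ext λ τ → begin
  eval τ (X [T↦ Y ,F↦ Z ])                        ≡⟨ eval-replace τ X Y Z ⟩
  eval τ X [T↦ eval τ Y ,F↦ eval τ Z ]            ≡⟨ cong₂ (λ x y → x [T↦ y ,F↦ eval τ Z ]) (eval-≡ X≈X′ τ) (eval-≡ Y≈Y′ τ) ⟩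
  eval τ X′ [T↦ eval τ Y′ ,F↦ eval τ Z ]          ≡⟨ cong (λ z → eval τ X′ [T↦ eval τ Y′ ,F↦ z ]) (eval-≡ Z≈Z′ τ) ⟩
  eval τ X′ [T↦ eval τ Y′ ,F↦ eval τ Z′ ]         ≡⟨ eval-replace τ X′ Y′ Z′ ⟨
  eval τ (X′ [T↦ Y′ ,F↦ Z′ ])                     ∎
  where open ≡-Reasoning

L-cong : ∀ a {X Y} → X ≈ Y → L a X ≈ L a Y
L-cong a {X} {Y} X≈Y = eval-ext λ τ →
  trans (eval-L τ a X) (trans (eval-≡ X≈Y (τ [ a ≔ true ])) (sym (eval-L τ a Y)))

R-cong : ∀ a {X Y} → X ≈ Y → R a X ≈ R a Y
R-cong a {X} {Y} X≈Y = eval-ext λ τ →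
  trans (eval-R τ a X) (trans (eval-≡ X≈Y (τ [ a ≔ false ])) (sym (eval-R τ a Y)))

expand : List Atom → Tree → Tree
expand [] X = X
expand (a ∷ β) X = node (expand β (L a X)) a (expand β (R a X))

eval-expand : ∀ τ β X → eval τ (expand β X) ≡ eval τ X
eval-expand τ [] X = refl
eval-expand τ (a ∷ β) X with τ a in τa
... | true  = trans (eval-expand τ β (L a X)) (trans (eval-L τ a X) (eval-cong ([≔]-id τa) X))
... | false = trans (eval-expand τ β (R a X)) (trans (eval-R τ a X) (eval-cong ([≔]-id τa) X))

eval-atomless : ∀ {X} → AtomsIn [] X → ∀ τ → eval τ X ≡ X
eval-atomless T τ = refl
eval-atomless F τ = refl
eval-atomless U τ = refl

expand-cong : ∀ β {X Y} → AtomsIn β X → AtomsIn β Y → X ≈ Y → expand β X ≡ expand β Y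
expand-cong [] hX hY X≈Y =
  trans (sym (eval-atomless hX τ)) (trans (eval-≡ X≈Y τ) (eval-atomless hY τ))
  where τ = const false
expand-cong (a ∷ β) hX hY X≈Y =
  cong₂ (λ l r → node l a r)
    (expand-cong β (AtomsIn-L hX) (AtomsIn-L hY) (L-cong a X≈Y))
    (expand-cong β (AtomsIn-R hX) (AtomsIn-R hY) (R-cong a X≈Y))

spine : Tree → List Atom
spine (node X a _) = a ∷ spine X
spine leaf = []

spine-expand : ∀ β {X} → AtomsIn β X → spine (expand β X) ≡ β
spine-expand [] T = refl
spine-expand [] F = refl
spine-expand [] U = refl
spine-expand (a ∷ β) hX = cong (a ∷_) (spine-expand β (AtomsIn-L hX))

full : List Atom → Tree → Tree
full [] X = X
full (a ∷ β) X = node (full β X) a (full β X)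

full-replace : ∀ β X Y Z → full β X [T↦ Y ,F↦ Z ] ≡ full β (X [T↦ Y ,F↦ Z ])
full-replace [] X Y Z = refl
full-replace (a ∷ β) X Y Z = cong (λ t → node t a t) (full-replace β X Y Z)

feU-F̃ : ∀ β → feU (ι (F̃ β)) ≡ full β F
feU-F̃ [] = refl
feU-F̃ (a ∷ β) rewrite feU-F̃ β | full-replace β F F F = refl

L-full : ∀ {a β} X → a ∉ β → L a (full β X) ≡ full β (L a X)
L-full {β = []} X a∉β = refl
L-full {a} {b ∷ β} X a∉β with a ≡ᵇ b in a≡ᵇb
... | true  = ⊥-elim (a∉β (here (≡ᵇ-true⇒≡ a≡ᵇb)))
... | false = cong (λ t → node t b t) (L-full X (a∉β ∘ there))

R-full : ∀ {a β} X → a ∉ β → R a (full β X) ≡ full β (R a X)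
R-full {β = []} X a∉β = refl
R-full {a} {b ∷ β} X a∉β with a ≡ᵇ b in a≡ᵇb
... | true  = ⊥-elim (a∉β (here (≡ᵇ-true⇒≡ a≡ᵇb)))
... | false = cong (λ t → node t b t) (R-full X (a∉β ∘ there))

length≤size-full : ∀ β X → length β ≤ size (full β X)
length≤size-full [] X = z≤n
length≤size-full (a ∷ β) X = s≤s (≤-trans (length≤size-full β X) (m≤m+n _ _))

-- Distinctness of β is what lets L and R at the root pass through the rest of the full tree.
m′-full : ∀ {β X} n → Unique β → AtomsIn β X → length β ≤ n → m′ n (full β X) ≡ expand β X
m′-full {[]} n [] T _ = refl
m′-full {[]} n [] F _ = refl
m′-full {[]} n [] U _ = refl
m′-full {a ∷ β} {X} (suc n) (a∉β ∷ uniq) hX (s≤s β≤n)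
  rewrite L-full X (All¬⇒¬Any a∉β) | R-full X (All¬⇒¬Any a∉β) =
  cong₂ (λ l r → node l a r)
    (m′-full n uniq (AtomsIn-L hX) β≤n)
    (m′-full n uniq (AtomsIn-R hX) β≤n)

clfe≡expand : ∀ P → clfe P ≡ expand (α P) (fe P)
clfe≡expand P = begin
  m (feU (ι (F̃ (α P))) [T↦ fe P [T↦ T ,F↦ T ] ,F↦ fe P ])
    ≡⟨ cong (λ t → m (t [T↦ fe P [T↦ T ,F↦ T ] ,F↦ fe P ])) (feU-F̃ (α P)) ⟩
  m (full (α P) F [T↦ fe P [T↦ T ,F↦ T ] ,F↦ fe P ])
    ≡⟨ cong m (full-replace (α P) F (fe P [T↦ T ,F↦ T ]) (fe P)) ⟩
  m (full (α P) (fe P))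
    ≡⟨ m′-full _ (α-unique P) (AtomsIn-fe P) (length≤size-full (α P) (fe P)) ⟩
  expand (α P) (fe P) ∎
  where open ≡-Reasoning

eval-clfe : ∀ τ P → eval τ (clfe P) ≡ eval τ (fe P)
eval-clfe τ P = trans (cong (eval τ) (clfe≡expand P)) (eval-expand τ (α P) (fe P))

spine-clfe : ∀ P → spine (clfe P) ≡ α P
spine-clfe P = trans (cong spine (clfe≡expand P)) (spine-expand (α P) (AtomsIn-fe P))

=clfe⇔ : ∀ P Q → P =clfe Q ⇔ (α P ≡ α Q × fe P ≈ fe Q)
=clfe⇔ P Q = mk⇔ sound complete
  where
  sound : P =clfe Q → α P ≡ α Q × fe P ≈ fe Q
  sound e = trans (sym (spine-clfe P)) (trans (cong spine e) (spine-clfe Q))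
          , eval-ext λ τ → trans (sym (eval-clfe τ P)) (trans (cong (eval τ) e) (eval-clfe τ Q))

  complete : α P ≡ α Q × fe P ≈ fe Q → P =clfe Q
  complete (αP≡αQ , feP≈feQ) = begin
    clfe P                 ≡⟨ clfe≡expand P ⟩
    expand (α P) (fe P)    ≡⟨ cong (λ β → expand β (fe P)) αP≡αQ ⟩
    expand (α Q) (fe P)    ≡⟨ expand-cong (α Q) hP (AtomsIn-fe Q) feP≈feQ ⟩
    expand (α Q) (fe Q)    ≡⟨ clfe≡expand Q ⟨
    clfe Q                 ∎
    where
    open ≡-Reasoning
    hP = subst (λ β → AtomsIn β (fe P)) αP≡αQ (AtomsIn-fe P)

¬ₛ-cong : ∀ P Q → P =clfe Q → (¬ₛ P) =clfe (¬ₛ Q)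
¬ₛ-cong P Q e with to (=clfe⇔ P Q) e
... | αP≡αQ , P≈Q = from (=clfe⇔ (¬ₛ P) (¬ₛ Q)) (αP≡αQ , replace-cong P≈Q ≈-refl ≈-refl)

∧ₛ-cong : ∀ P Q P′ Q′ → P =clfe Q → P′ =clfe Q′ → (P ∧ₛ P′) =clfe (Q ∧ₛ Q′)
∧ₛ-cong P Q P′ Q′ e e′ with to (=clfe⇔ P Q) e | to (=clfe⇔ P′ Q′) e′
... | αP≡αQ , P≈Q | αP′≡αQ′ , P′≈Q′ =
  from (=clfe⇔ (P ∧ₛ P′) (Q ∧ₛ Q′))
    (cong₂ merge αP≡αQ αP′≡αQ′ , replace-cong P≈Q P′≈Q′ (replace-cong P′≈Q′ ≈-refl ≈-refl))

∨ₛ-cong : ∀ P Q P′ Q′ → P =clfe Q → P′ =clfe Q′ → (P ∨ₛ P′) =clfe (Q ∨ₛ Q′)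
∨ₛ-cong P Q P′ Q′ e e′ with to (=clfe⇔ P Q) e | to (=clfe⇔ P′ Q′) e′
... | αP≡αQ , P≈Q | αP′≡αQ′ , P′≈Q′ =
  from (=clfe⇔ (P ∨ₛ P′) (Q ∨ₛ Q′))
    (cong₂ merge αP≡αQ αP′≡αQ′ , replace-cong P≈Q (replace-cong P′≈Q′ ≈-refl ≈-refl) P′≈Q′)

data UFree : Tree → Set where
  T    : UFree T
  F    : UFree F
  node : ∀ {X a Y} → UFree X → UFree Y → UFree (node X a Y)

replace-UFree : ∀ {X Y Z} → UFree X → UFree Y → UFree Z → UFree (X [T↦ Y ,F↦ Z ])
replace-UFree T uY uZ = uY
replace-UFree F uY uZ = uZ
replace-UFree (node uX uX′) uY uZ = node (replace-UFree uX uY uZ) (replace-UFree uX′ uY uZ)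

fe-UFree : ∀ P → UFree (fe P)
fe-UFree T = T
fe-UFree F = F
fe-UFree (atom a) = node T F
fe-UFree (¬ₛ P) = replace-UFree (fe-UFree P) F T
fe-UFree (P ∧ₛ Q) = replace-UFree (fe-UFree P) (fe-UFree Q) (replace-UFree (fe-UFree Q) F F)
fe-UFree (P ∨ₛ Q) = replace-UFree (fe-UFree P) (replace-UFree (fe-UFree Q) T T) (fe-UFree Q)

eval-UFree : ∀ τ {X} → UFree X → eval τ X ≢ U
eval-UFree τ T ()
eval-UFree τ F ()
eval-UFree τ (node {a = a} uX uY) with τ a
... | true  = eval-UFree τ uX
... | false = eval-UFree τ uY

clfe≢U : ∀ P → clfe P ≢ U
clfe≢U P clfeP≡U =
  eval-UFree τ (fe-UFree P) (trans (sym (eval-clfe τ P)) (cong (eval τ) clfeP≡U))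
  where τ = const false

Pointwise-map : ∀ {A B : Set} {R : A → A → Set} {S : B → B → Set} {f : A → B} →
                (∀ x y → R x y → S (f x) (f y)) →
                ∀ {x y} → Pointwise R x y → Pointwise S (Maybe.map f x) (Maybe.map f y)
Pointwise-map f-cong (just r) = just (f-cong _ _ r)
Pointwise-map f-cong nothing = nothing

Pointwise-zipWith : ∀ {A B : Set} {R : A → A → Set} {S : B → B → Set} {f : A → A → B} →
                    (∀ x y x′ y′ → R x y → R x′ y′ → S (f x x′) (f y y′)) →
                    ∀ {x y x′ y′} → Pointwise R x y → Pointwise R x′ y′ →
                    Pointwise S (zipWith f x x′) (zipWith f y y′)
Pointwise-zipWith f-cong (just r) (just r′) = just (f-cong _ _ _ _ r r′)
Pointwise-zipWith f-cong (just r) nothing = nothing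
Pointwise-zipWith f-cong nothing _ = nothing

toSP-¬ : ∀ P → toSP (¬ᵤ P) ≡ Maybe.map ¬ₛ_ (toSP P)
toSP-¬ P with toSP P
... | just p  = refl
... | nothing = refl

toSP-∧ : ∀ P Q → toSP (P ∧ᵤ Q) ≡ zipWith _∧ₛ_ (toSP P) (toSP Q)
toSP-∧ P Q with toSP P | toSP Q
... | just p  | just q  = refl
... | just p  | nothing = refl
... | nothing | _       = refl

toSP-∨ : ∀ P Q → toSP (P ∨ᵤ Q) ≡ zipWith _∨ₛ_ (toSP P) (toSP Q)
toSP-∨ P Q with toSP P | toSP Q
... | just p  | just q  = refl
... | just p  | nothing = refl
... | nothing | _       = refl

clfeU≡maybe : ∀ P → clfeU P ≡ maybe′ clfe U (toSP P)
clfeU≡maybe P with toSP P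
... | just p  = refl
... | nothing = refl

maybe-clfe⇔ : ∀ x y → maybe′ clfe U x ≡ maybe′ clfe U y ⇔ Pointwise _=clfe_ x y
maybe-clfe⇔ x y = mk⇔ (⇒Pointwise x y) Pointwise⇒
  where
  ⇒Pointwise : ∀ x y → maybe′ clfe U x ≡ maybe′ clfe U y → Pointwise _=clfe_ x y
  ⇒Pointwise (just p) (just q) e = just e
  ⇒Pointwise (just p) nothing e = ⊥-elim (clfe≢U p e)
  ⇒Pointwise nothing (just q) e = ⊥-elim (clfe≢U q (sym e))
  ⇒Pointwise nothing nothing e = nothing

  Pointwise⇒ : Pointwise _=clfe_ x y → maybe′ clfe U x ≡ maybe′ clfe U y
  Pointwise⇒ (just e) = e
  Pointwise⇒ nothing = refl

=clfeU⇔ : ∀ P Q → P =clfeU Q ⇔ Pointwise _=clfe_ (toSP P) (toSP Q)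
=clfeU⇔ P Q rewrite clfeU≡maybe P | clfeU≡maybe Q = maybe-clfe⇔ (toSP P) (toSP Q)

¬ᵤ-cong : ∀ P Q → P =clfeU Q → (¬ᵤ P) =clfeU (¬ᵤ Q)
¬ᵤ-cong P Q e = from (=clfeU⇔ (¬ᵤ P) (¬ᵤ Q)) lifted
  where
  lifted : Pointwise _=clfe_ (toSP (¬ᵤ P)) (toSP (¬ᵤ Q))
  lifted rewrite toSP-¬ P | toSP-¬ Q = Pointwise-map ¬ₛ-cong (to (=clfeU⇔ P Q) e)

∧ᵤ-cong : ∀ P Q P′ Q′ → P =clfeU Q → P′ =clfeU Q′ → (P ∧ᵤ P′) =clfeU (Q ∧ᵤ Q′)
∧ᵤ-cong P Q P′ Q′ e e′ = from (=clfeU⇔ (P ∧ᵤ P′) (Q ∧ᵤ Q′)) lifted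
  where
  lifted : Pointwise _=clfe_ (toSP (P ∧ᵤ P′)) (toSP (Q ∧ᵤ Q′))
  lifted rewrite toSP-∧ P P′ | toSP-∧ Q Q′ =
    Pointwise-zipWith ∧ₛ-cong (to (=clfeU⇔ P Q) e) (to (=clfeU⇔ P′ Q′) e′)

∨ᵤ-cong : ∀ P Q P′ Q′ → P =clfeU Q → P′ =clfeU Q′ → (P ∨ᵤ P′) =clfeU (Q ∨ᵤ Q′)
∨ᵤ-cong P Q P′ Q′ e e′ = from (=clfeU⇔ (P ∨ᵤ P′) (Q ∨ᵤ Q′)) lifted
  where
  lifted : Pointwise _=clfe_ (toSP (P ∨ᵤ P′)) (toSP (Q ∨ᵤ Q′))
  lifted rewrite toSP-∨ P P′ | toSP-∨ Q Q′ =
    Pointwise-zipWith ∨ₛ-cong (to (=clfeU⇔ P Q) e) (to (=clfeU⇔ P′ Q′) e′)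

lemma6p5 :
  ((∀ P Q → P =clfe Q → (¬ₛ P) =clfe (¬ₛ Q))
    × (∀ P Q P′ Q′ → P =clfe Q → P′ =clfe Q′ → (P ∧ₛ P′) =clfe (Q ∧ₛ Q′))
    × (∀ P Q P′ Q′ → P =clfe Q → P′ =clfe Q′ → (P ∨ₛ P′) =clfe (Q ∨ₛ Q′)))
  × ((∀ P Q → P =clfeU Q → (¬ᵤ P) =clfeU (¬ᵤ Q))
    × (∀ P Q P′ Q′ → P =clfeU Q → P′ =clfeU Q′ → (P ∧ᵤ P′) =clfeU (Q ∧ᵤ Q′))
    × (∀ P Q P′ Q′ → P =clfeU Q → P′ =clfeU Q′ → (P ∨ᵤ P′) =clfeU (Q ∨ᵤ Q′)))
lemma6p5 = (¬ₛ-cong , ∧ₛ-cong , ∨ₛ-cong) , (¬ᵤ-cong , ∧ᵤ-cong , ∨ᵤ-cong)
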